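{- Let $(L,\preceq)$ be a lattice, $\delta$ a local congruence on $L$, and $[x]_\delta,[y]_\delta\in L/\delta$. Suppose there exists exactly one class $[c]_\delta\in L/\delta$ such that $[x]_\delta\preceq_\delta[c]_\delta\preceq_\delta[y]_\delta$ and $[y]_\delta\preceq_\delta[c]_\delta\preceq_\delta[x]_\delta$, with elements $x_1,x_2\in[x]_\delta$, $c_1,c_2\in[c]_\delta$, $y_1,y_2\in[y]_\delta$ satisfying $x_1\preceq c_1\preceq y_1$ and $y_2\preceq c_2\preceq x_2$. Then $[x]_\delta=[y]_\delta$.
   Context: A local congruence on a lattice $(L,\preceq)$ is an equivalence relation $\delta$ on $L$ each of whose equivalence classes is a sublattice of $L$ and is convex (if $u,v$ are in a class and $u\preceq w\preceq v$, then $w$ is in that class). $[a]_\delta$ denotes the class of $a$ and $L/\delta$ the set of classes. A $\delta$-sequence from $p_0$ to $p_n$ is a finite sequence $(p_0,p_1,\dots,p_n)$, $n\ge1$, of elements of $L$ such that for each $i\in\{1,\dots,n\}$ either $(p_{i-1},p_i)\in\delta$ or $p_{i-1}\preceq p_i$. The relation $\preceq_\delta$ on $L/\delta$ is defined by $[x]_\delta\preceq_\delta[y]_\delta$ iff there exist $x'\in[x]_\delta$, $y'\in[y]_\delta$ and a $\delta$-sequence from $x'$ to $y'$. -}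

module Defs where

open import Level using (Level; _⊔_)
open import Data.Product using (Σ; ∃; _×_; _,_)
open import Data.Sum using (_⊎_)
open import Relation.Binary.Core using (Rel)
open import Relation.Binary.Structures using (IsEquivalence)
open import Relation.Binary.Lattice.Bundles using (Lattice)

module _ {c ℓ₁ ℓ₂ : Level} (L : Lattice c ℓ₁ ℓ₂) where
  open Lattice L

  -- A local congruence: an equivalence relation δ whose classes are
  -- sublattices (closed under ∧ and ∨) and convex.
  -- (Closure of classes under the setoid equality ≈ follows from convexity,
  --  since ≈ implies ≤ in both directions.)
  record IsLocalCongruence {ℓ : Level} (δ : Rel Carrier ℓ) : Set (c ⊔ ℓ₂ ⊔ ℓ) where
    field
      isEquivalence : IsEquivalence δ
      ∧-closed : ∀ {a u v} → δ a u → δ a v → δ a (u ∧ v)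
      ∨-closed : ∀ {a u v} → δ a u → δ a v → δ a (u ∨ v)
      convex   : ∀ {a u v w} → δ a u → δ a v → u ≤ w → w ≤ v → δ a w

  module _ {ℓ : Level} (δ : Rel Carrier ℓ) where

    data δ-Sequence : Carrier → Carrier → Set (c ⊔ ℓ₂ ⊔ ℓ) where
      [_] : ∀ {p q} → δ p q ⊎ p ≤ q → δ-Sequence p q
      _∷_ : ∀ {p q r} → δ p q ⊎ p ≤ q → δ-Sequence q r → δ-Sequence p r

    _≼δ_ : Carrier → Carrier → Set (c ⊔ ℓ₂ ⊔ ℓ)
    x ≼δ y = ∃ λ x' → ∃ λ y' → δ x x' × δ y y' × δ-Sequence x' y'

-- The chains x₁ ≤ c₁ ≤ y₁ and y₂ ≤ c₂ ≤ x₂ give [x] ≼δ [y] and [y] ≼δ [x].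
-- Then both [x] and [y] lie between [x] and [y] in both directions, so by
-- uniqueness each is the class [c], hence [x] = [y].

module Submission where

open import Defs
open import Level using (Level; _⊔_)
open import Data.Product using (∃; _×_; _,_)
open import Data.Sum using (inj₁; inj₂)
open import Relation.Binary.Core using (Rel)
open import Relation.Binary.Structures using (IsEquivalence)
open import Relation.Binary.Lattice.Bundles using (Lattice)

module _ {c ℓ₁ ℓ₂ ℓ : Level} (L : Lattice c ℓ₁ ℓ₂)
         {δ : Rel (Lattice.Carrier L) ℓ} (δ-isEquivalence : IsEquivalence δ) where
  open Lattice L using (_≤_)
  open IsEquivalence δ-isEquivalence using (refl)
  private
    _≼_ : Lattice.Carrier L → Lattice.Carrier L → Set (c ⊔ ℓ₂ ⊔ ℓ)
    _≼_ = _≼δ_ L δ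

  ≼δ-refl : ∀ {x} → x ≼ x
  ≼δ-refl {x} = x , x , refl , refl , [ inj₁ refl ]

  ≼δ-via-chain : ∀ {x y x₁ c₁ y₁} → δ x x₁ → δ y y₁ → x₁ ≤ c₁ → c₁ ≤ y₁ → x ≼ y
  ≼δ-via-chain {x₁ = x₁} {y₁ = y₁} xx₁ yy₁ x₁≤c₁ c₁≤y₁ =
    x₁ , y₁ , xx₁ , yy₁ , (inj₂ x₁≤c₁ ∷ [ inj₂ c₁≤y₁ ])

proposition22 : ∀ {c ℓ₁ ℓ₂ ℓ : Level} (L : Lattice c ℓ₁ ℓ₂)
    (δ : Rel (Lattice.Carrier L) ℓ) → IsLocalCongruence L δ →
    (x y : Lattice.Carrier L) →
    let open Lattice L
        _≼_ = _≼δ_ L δ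
    in (∃ λ cc →
          -- [x] ≼δ [c] ≼δ [y]  and  [y] ≼δ [c] ≼δ [x]
          ((x ≼ cc × cc ≼ y) × (y ≼ cc × cc ≼ x))
          -- [c] is the only class with this property
          × (∀ d → (x ≼ d × d ≼ y) × (y ≼ d × d ≼ x) → δ d cc)
          -- x₁,x₂ ∈ [x], c₁,c₂ ∈ [c], y₁,y₂ ∈ [y], x₁ ≤ c₁ ≤ y₁, y₂ ≤ c₂ ≤ x₂
          × (∃ λ x₁ → ∃ λ x₂ → ∃ λ c₁ → ∃ λ c₂ → ∃ λ y₁ → ∃ λ y₂ →
               δ x x₁ × δ x x₂ × δ cc c₁ × δ cc c₂ × δ y y₁ × δ y y₂
               × (x₁ ≤ c₁ × c₁ ≤ y₁) × (y₂ ≤ c₂ × c₂ ≤ x₂)))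
       → δ x y
proposition22 L δ lc x y
  (cc , _ , unique , _ , _ , _ , _ , _ , _ ,
   xx₁ , xx₂ , _ , _ , yy₁ , yy₂ , (x₁≤c₁ , c₁≤y₁) , (y₂≤c₂ , c₂≤x₂)) =
  trans x∼c (sym y∼c)
  where
  open IsLocalCongruence lc using (isEquivalence)
  open IsEquivalence isEquivalence using (trans; sym)
  x≼y = ≼δ-via-chain L isEquivalence xx₁ yy₁ x₁≤c₁ c₁≤y₁
  y≼x = ≼δ-via-chain L isEquivalence yy₂ xx₂ y₂≤c₂ c₂≤x₂
  x∼c = unique x ((≼δ-refl L isEquivalence , x≼y) , (y≼x , ≼δ-refl L isEquivalence))
  y∼c = unique y ((x≼y , ≼δ-refl L isEquivalence) , (≼δ-refl L isEquivalence , y≼x))
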